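{- For integers $k\geq 1$ and $n>k+1$, $\Bigl(\sum_{i=k+1}^{n-1}\frac{1}{u_i}\Bigr)+\frac{1}{u_{k+1}}+\frac{1}{u_{n-1}}\leq \frac{1}{u_n}+\frac{1}{u_k}$.
   Context: $F_n$ denotes the Fibonacci numbers ($F_0=0$, $F_1=1$, $F_n=F_{n-1}+F_{n-2}$), and $u_i=F_{2i}$ for $i\geq 1$. -}

module Defs where

open import Data.Nat using (ℕ; zero; suc; _+_; _*_)
open import Data.Integer using (+_)
open import Data.Rational using (ℚ; 0ℚ; _/_) renaming (_+_ to _+ℚ_)

F : ℕ → ℕ
F zero = 0
F (suc zero) = 1
F (suc (suc n)) = F (suc n) + F n

u : ℕ → ℕ
u i = F (2 * i)

-- reciprocal of a natural number as a rational (1/0 := 0 by convention;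
-- only applied to positive arguments in the statement)
inv : ℕ → ℚ
inv zero = 0ℚ
inv (suc m) = + 1 / suc m

sumFrom : ℕ → ℕ → (ℕ → ℚ) → ℚ
sumFrom a zero f = 0ℚ
sumFrom a (suc len) f = f a +ℚ sumFrom (suc a) len f

{-# OPTIONS --safe #-}
module Submission where

-- With a i = 1 / u i, the recurrence u (m+2) + u m = 3 u (m+1) and Cassini's identity
-- u (m+2) u m + 1 = u (m+1)² give a (m+2) + a m = 3 u (m+1) / (u (m+1)² - 1) ≥ 3 a (m+1).
-- Passing from n to n + 1 adds 2 a n - a (n-1) to the left-hand side and a (n+1) - a n to
-- the right-hand side, so each induction step is exactly this three-term inequality, and so
-- is the base case n = k + 2.

open import Defs
open import Data.Nat using (ℕ; zero; suc; _<_; _≤_; _+_; _*_; _∸_; s≤s; z≤n)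
open import Data.Rational using (ℚ) renaming (_+_ to _+ℚ_; _≤_ to _≤ℚ_)

open import Data.Nat.Properties
  using ( +-suc; *-suc; +-comm; +-cancelʳ-≡; *-distribˡ-+; *-monoʳ-≤
        ; m≤m+n; m≤n+m; n≤1+n; ≤-refl; ≤-trans; m+n∸n≡m; m≤n⇒∃[o]m+o≡n )
import Data.Nat.Properties as ℕ
open import Data.Nat.Solver using (module +-*-Solver)
open import Data.Integer using (+_; +≤+)
import Data.Rational as ℚ
import Data.Rational.Properties as ℚ
import Data.Rational.Solver as ℚ
open import Data.Rational.Unnormalised as ℚᵘ using (ℚᵘ; mkℚᵘ; *≤*)
import Data.Rational.Unnormalised.Properties as ℚᵘ
open import Data.Product using (_,_)
open import Relation.Binary.PropositionalEquality

F-skip : ∀ n → F (4 + n) + F n ≡ 3 * F (2 + n)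
F-skip n = solve 2 (λ a b → ((a :+ b) :+ a) :+ (a :+ b) :+ b := con 3 :* (a :+ b)) refl (F (suc n)) (F n)
  where open +-*-Solver

F-suc-pos : ∀ n → 1 ≤ F (suc n)
F-suc-pos zero    = s≤s z≤n
F-suc-pos (suc n) = ≤-trans (F-suc-pos n) (m≤m+n (F (suc n)) (F n))

u-suc : ∀ m → u (suc m) ≡ F (2 + 2 * m)
u-suc m = cong F (*-suc 2 m)

u-pos : ∀ m → 1 ≤ m → 1 ≤ u m
u-pos (suc m) _ = subst (1 ≤_) (sym (u-suc m)) (F-suc-pos (suc (2 * m)))

u-recurrence : ∀ m → u (2 + m) + u m ≡ 3 * u (1 + m)
u-recurrence m = begin
  u (2 + m) + u m              ≡⟨ cong (_+ u m) (trans (u-suc (suc m)) (cong (λ i → F (2 + i)) (*-suc 2 m))) ⟩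
  F (4 + 2 * m) + F (2 * m)    ≡⟨ F-skip (2 * m) ⟩
  3 * F (2 + 2 * m)            ≡⟨ cong (3 *_) (u-suc m) ⟨
  3 * u (1 + m)                ∎
  where open ≡-Reasoning

cassini-step : ∀ {t c} a b d e → e + b ≡ t * d → d + a ≡ t * b →
  d * a + c ≡ b * b → e * b + c ≡ d * d
cassini-step {t} {c} a b d e rec₁ rec₀ cas = +-cancelʳ-≡ (d * a) (e * b + c) (d * d) (begin
  e * b + c + d * a    ≡⟨ solve 5 (λ e b c d a → e :* b :+ c :+ d :* a := e :* b :+ (d :* a :+ c)) refl e b c d a ⟩
  e * b + (d * a + c)  ≡⟨ cong (_+_ (e * b)) cas ⟩
  e * b + b * b        ≡⟨ solve 2 (λ e b → e :* b :+ b :* b := (e :+ b) :* b) refl e b ⟩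
  (e + b) * b          ≡⟨ cong (_* b) rec₁ ⟩
  t * d * b            ≡⟨ solve 3 (λ t d b → t :* d :* b := d :* (t :* b)) refl t d b ⟩
  d * (t * b)          ≡⟨ cong (d *_) rec₀ ⟨
  d * (d + a)          ≡⟨ *-distribˡ-+ d d a ⟩
  d * d + d * a        ∎)
  where open ≡-Reasoning
        open +-*-Solver

cassini : ∀ {t c} (x : ℕ → ℕ) → (∀ m → x (2 + m) + x m ≡ t * x (1 + m)) →
  x 2 * x 0 + c ≡ x 1 * x 1 → ∀ m → x (2 + m) * x m + c ≡ x (1 + m) * x (1 + m)
cassini x rec base zero = base
cassini {t} x rec base (suc m) =
  cassini-step {t} (x m) (x (1 + m)) (x (2 + m)) (x (3 + m))
    (rec (suc m)) (rec m) (cassini {t} x rec base m)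

u-cassini : ∀ m → u (2 + m) * u m + 1 ≡ u (1 + m) * u (1 + m)
u-cassini = cassini {3} u u-recurrence refl

toℚᵘ-inv : ∀ n → ℚ.toℚᵘ (inv (suc n)) ℚᵘ.≃ mkℚᵘ (+ 1) n
toℚᵘ-inv n = ℚ.toℚᵘ-fromℚᵘ (mkℚᵘ (+ 1) n)

three-inv≤inv+inv : ∀ {p q r} → 1 ≤ p → 1 ≤ q → 1 ≤ r → 3 * (r * p) ≤ q * (r + p) →
  inv q +ℚ inv q +ℚ inv q ≤ℚ inv r +ℚ inv p
three-inv≤inv+inv {suc p} {suc q} {suc r} _ _ _ 3rp≤q[r+p] =
  ℚ.toℚᵘ-cancel-≤ (let open ℚᵘ.≤-Reasoning in begin
  ℚ.toℚᵘ (inv Q +ℚ inv Q +ℚ inv Q)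
    ≃⟨ ℚᵘ.≃-trans (ℚ.toℚᵘ-homo-+ (inv Q +ℚ inv Q) (inv Q))
                  (ℚᵘ.+-cong (ℚᵘ.≃-trans (ℚ.toℚᵘ-homo-+ (inv Q) (inv Q)) (ℚᵘ.+-cong (toℚᵘ-inv q) (toℚᵘ-inv q)))
                             (toℚᵘ-inv q)) ⟩
  1/Q ℚᵘ.+ 1/Q ℚᵘ.+ 1/Q
    ≤⟨ *≤* (+≤+ cross-multiplied) ⟩
  1/R ℚᵘ.+ 1/P
    ≃⟨ ℚᵘ.≃-trans (ℚ.toℚᵘ-homo-+ (inv R) (inv P)) (ℚᵘ.+-cong (toℚᵘ-inv r) (toℚᵘ-inv p)) ⟨
  ℚ.toℚᵘ (inv R +ℚ inv P) ∎)
  where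
  P Q R : ℕ
  P = suc p
  Q = suc q
  R = suc r
  1/P 1/Q 1/R : ℚᵘ
  1/P = mkℚᵘ (+ 1) p
  1/Q = mkℚᵘ (+ 1) q
  1/R = mkℚᵘ (+ 1) r
  -- the *≤* condition for the unnormalised sums above, verbatim
  cross-multiplied : ((1 * Q + 1 * Q) * Q + 1 * (Q * Q)) * (R * P) ≤ (1 * P + 1 * R) * (Q * Q * Q)
  cross-multiplied = let open ℕ.≤-Reasoning; open +-*-Solver in begin
    ((1 * Q + 1 * Q) * Q + 1 * (Q * Q)) * (R * P)
      ≡⟨ solve 3 (λ Q R P → ((con 1 :* Q :+ con 1 :* Q) :* Q :+ con 1 :* (Q :* Q)) :* (R :* P)
                            := (Q :* Q) :* (con 3 :* (R :* P))) refl Q R P ⟩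
    (Q * Q) * (3 * (R * P))
      ≤⟨ *-monoʳ-≤ (Q * Q) 3rp≤q[r+p] ⟩
    (Q * Q) * (Q * (R + P))
      ≡⟨ solve 3 (λ Q R P → (Q :* Q) :* (Q :* (R :+ P)) := (con 1 :* P :+ con 1 :* R) :* (Q :* Q :* Q)) refl Q R P ⟩
    (1 * P + 1 * R) * (Q * Q * Q) ∎

three-inv-u≤inv-u+inv-u : ∀ {m} → 1 ≤ m →
  inv (u (1 + m)) +ℚ inv (u (1 + m)) +ℚ inv (u (1 + m)) ≤ℚ inv (u (2 + m)) +ℚ inv (u m)
three-inv-u≤inv-u+inv-u {m} 1≤m =
  three-inv≤inv+inv (u-pos m 1≤m) (u-pos (1 + m) (s≤s z≤n)) (u-pos (2 + m) (s≤s z≤n)) (begin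
  3 * (r * p)      ≤⟨ *-monoʳ-≤ 3 (m≤m+n (r * p) 1) ⟩
  3 * (r * p + 1)  ≡⟨ cong (3 *_) (u-cassini m) ⟩
  3 * (q * q)      ≡⟨ solve 1 (λ q → con 3 :* (q :* q) := q :* (con 3 :* q)) refl q ⟩
  q * (3 * q)      ≡⟨ cong (q *_) (u-recurrence m) ⟨
  q * (r + p)      ∎)
  where
  open ℕ.≤-Reasoning
  open +-*-Solver
  p q r : ℕ
  p = u m
  q = u (1 + m)
  r = u (2 + m)

sumFrom-snoc : ∀ s L (f : ℕ → ℚ) → sumFrom s (suc L) f ≡ sumFrom s L f +ℚ f (L + s)
sumFrom-snoc s zero    f = trans (ℚ.+-identityʳ (f s)) (sym (ℚ.+-identityˡ (f s)))
sumFrom-snoc s (suc L) f = begin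
  f s +ℚ sumFrom (suc s) (suc L) f              ≡⟨ cong (f s +ℚ_) (sumFrom-snoc (suc s) L f) ⟩
  f s +ℚ (sumFrom (suc s) L f +ℚ f (L + suc s)) ≡⟨ ℚ.+-assoc (f s) _ _ ⟨
  sumFrom s (suc L) f +ℚ f (L + suc s)          ≡⟨ cong (λ i → sumFrom s (suc L) f +ℚ f i) (+-suc L s) ⟩
  sumFrom s (suc L) f +ℚ f (suc L + s)          ∎
  where open ≡-Reasoning

sumFrom-telescope : ∀ (f : ℕ → ℚ) k →
  (∀ m → k ≤ m → f (1 + m) +ℚ f (1 + m) +ℚ f (1 + m) ≤ℚ f (2 + m) +ℚ f m) →
  ∀ L → sumFrom (suc k) (suc L) f +ℚ f (suc k) +ℚ f (L + suc k) ≤ℚ f (suc L + suc k) +ℚ f k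
sumFrom-telescope f k 3f≤f+f zero =
  subst (_≤ℚ f (2 + k) +ℚ f k) (cong (λ a → a +ℚ f (suc k) +ℚ f (suc k)) (sym (ℚ.+-identityʳ (f (suc k)))))
    (3f≤f+f k ≤-refl)
sumFrom-telescope f k 3f≤f+f (suc L) = begin
  sumFrom (suc k) (2 + L) f +ℚ a +ℚ x       ≡⟨ cong (λ t → t +ℚ a +ℚ x) (sumFrom-snoc (suc k) (suc L) f) ⟩
  S +ℚ x +ℚ a +ℚ x                          ≡⟨ solve 4 (λ S a x y → S :+ x :+ a :+ x
                                                := (S :+ a :+ y) :+ (x :+ x :+ x) :- (x :+ y)) refl S a x y ⟩
  (S +ℚ a +ℚ y) +ℚ (x +ℚ x +ℚ x) ℚ.- (x +ℚ y)
    ≤⟨ ℚ.+-monoˡ-≤ (ℚ.- (x +ℚ y)) (ℚ.+-mono-≤ (sumFrom-telescope f k 3f≤f+f L) (3f≤f+f m k≤m)) ⟩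
  (x +ℚ b) +ℚ (z +ℚ y) ℚ.- (x +ℚ y)         ≡⟨ solve 4 (λ x b z y → (x :+ b) :+ (z :+ y) :- (x :+ y) := z :+ b) refl x b z y ⟩
  z +ℚ b                                    ∎
  where
  open ℚ.≤-Reasoning
  open ℚ.+-*-Solver
  m : ℕ
  m = L + suc k
  k≤m : k ≤ m
  k≤m = ≤-trans (n≤1+n k) (m≤n+m (suc k) L)
  S a b x y z : ℚ
  S = sumFrom (suc k) (suc L) f
  a = f (suc k)
  b = f k
  y = f m
  x = f (1 + m)
  z = f (2 + m)

corollary10 : (k n : ℕ) → 1 ≤ k → k + 1 < n →
    (sumFrom (k + 1) (n ∸ (k + 1)) (λ i → inv (u i)) +ℚ inv (u (k + 1)) +ℚ inv (u (n ∸ 1)))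
      ≤ℚ (inv (u n) +ℚ inv (u k))
corollary10 k n 1≤k k+1<n with m≤n⇒∃[o]m+o≡n k+1<n
-- n = suc L + suc k, so that n ∸ (k + 1) = suc L and n ∸ 1 = L + suc k
... | L , refl rewrite +-comm (k + 1) L | m+n∸n≡m (suc L) (k + 1) | +-comm k 1 =
  sumFrom-telescope (λ i → inv (u i)) k (λ m k≤m → three-inv-u≤inv-u+inv-u (≤-trans 1≤k k≤m)) L
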